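{- Let $\Gamma$ and $\Delta$ be contexts and let $\varrho$ be a substitution from $\Gamma$ to $\Delta$. Suppose that for every context $\Xi$ of fresh variables, all variables $a^A, b^B \in \{\Xi,\Gamma\}$ with $A\equiv[A_1,\dots,A_n]$ and $B\equiv[B_1,\dots,B_m]$, and all $M_i\in\Lambda^{\Xi,\Delta}(A_i)$, $N_i\in\Lambda^{\Xi,\Delta}(B_i)$, we have $$\varrho^\Xi_a\,M_1\cdots M_n =_{\beta\eta} \varrho^\Xi_b\,N_1\cdots N_m \implies a=b \text{ and } M_i=N_i \text{ for all } i.$$ Then $\varrho$ is a strong reduction, i.e. for every context $\Xi$ of fresh variables the map $\hat\varrho^\Xi\colon\Lambda^{\Xi,\Gamma}(0)\to\Lambda^{\Xi,\Delta}(0)$ is injective.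
   Context: Simply typed $\lambda$-calculus over a single base type $0$. Every type can be written uniquely as $[A_1,\dots,A_n]:=A_1\to\cdots\to A_n\to 0$ ($n\ge 0$; $[\,]=0$); the $A_i$ are its components. A context is a finite list $\Gamma=x_1^{C_1},\dots,x_k^{C_k}$ of distinct typed variables; $\{\Gamma\}$ is its set of (typed) variables; concatenation $\Xi,\Gamma$ assumes disjoint variables. Terms are identified up to $\beta\eta$-conversion (equivalently represented by $\beta$-normal $\eta$-long forms), and $=_{\beta\eta}$ denotes this equality. $\Lambda^{\Xi}(A)$ is the set of terms of type $A$ with free variables among $\{\Xi\}$. A substitution $\varrho$ from $\Gamma$ to $\Delta$ assigns to each $c^C\in\{\Gamma\}$ a term $\varrho_c\in\Lambda^{\Delta}(C)$. For a context $\Xi$ of fresh variables (disjoint from those of $\Gamma,\Delta$), $\varrho^\Xi$ is the substitution from $\Xi,\Gamma$ to $\Xi,\Delta$ with $\varrho^\Xi_c=\varrho_c$ for $c\in\{\Gamma\}$ and $\varrho^\Xi_d=d$ for $d\in\{\Xi\}$, and $\hat\varrho^\Xi\colon\Lambda^{\Xi,\Gamma}(0)\to\Lambda^{\Xi,\Delta}(0)$ is $M\mapsto M[\Gamma:=\varrho]$ (simultaneous substitution of $\varrho_c$ for each $c\in\{\Gamma\}$). -}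

module Defs where

open import Data.List using (List; []; _∷_; _++_)
open import Data.Sum using (_⊎_; inj₁; inj₂)

-- Types: [A₁,…,Aₙ] := A₁ → ⋯ → Aₙ → 0, the Aᵢ being the components.
data Ty : Set where
  arr : List Ty → Ty

o : Ty
o = arr []

comps : Ty → List Ty
comps (arr As) = As

-- Contexts (variables are de Bruijn indices, hence automatically distinct/fresh).
Ctx : Set
Ctx = List Ty

data _∋_ : Ctx → Ty → Set where
  here  : ∀ {Γ A} → (A ∷ Γ) ∋ A
  there : ∀ {Γ A B} → Γ ∋ A → (B ∷ Γ) ∋ A

data Tm (Γ : Ctx) : Ty → Set where
  var : ∀ {A} → Γ ∋ A → Tm Γ A
  app : ∀ {A As} → Tm Γ (arr (A ∷ As)) → Tm Γ A → Tm Γ (arr As)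
  lam : ∀ {A As} → Tm (A ∷ Γ) (arr As) → Tm Γ (arr (A ∷ As))

Ren : Ctx → Ctx → Set
Ren Γ Δ = ∀ {A} → Γ ∋ A → Δ ∋ A

Sub : Ctx → Ctx → Set
Sub Γ Δ = ∀ {A} → Γ ∋ A → Tm Δ A

liftR : ∀ {Γ Δ B} → Ren Γ Δ → Ren (B ∷ Γ) (B ∷ Δ)
liftR r here      = here
liftR r (there x) = there (r x)

ren : ∀ {Γ Δ A} → Ren Γ Δ → Tm Γ A → Tm Δ A
ren r (var x)   = var (r x)
ren r (app M N) = app (ren r M) (ren r N)
ren r (lam M)   = lam (ren (liftR r) M)

wk : ∀ {Γ A B} → Tm Γ A → Tm (B ∷ Γ) A
wk = ren there

liftS : ∀ {Γ Δ B} → Sub Γ Δ → Sub (B ∷ Γ) (B ∷ Δ)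
liftS σ here      = var here
liftS σ (there x) = wk (σ x)

sub : ∀ {Γ Δ A} → Sub Γ Δ → Tm Γ A → Tm Δ A
sub σ (var x)   = σ x
sub σ (app M N) = app (sub σ M) (sub σ N)
sub σ (lam M)   = lam (sub (liftS σ) M)

single : ∀ {Γ B} → Tm Γ B → Sub (B ∷ Γ) Γ
single N here      = N
single N (there x) = var x

infix 4 _≈_
data _≈_ {Γ : Ctx} : ∀ {A} → Tm Γ A → Tm Γ A → Set where
  β     : ∀ {A As} (M : Tm (A ∷ Γ) (arr As)) (N : Tm Γ A) →
          app (lam M) N ≈ sub (single N) M
  η     : ∀ {A As} (M : Tm Γ (arr (A ∷ As))) →
          M ≈ lam (app (wk M) (var here))
  appc  : ∀ {A As} {M M' : Tm Γ (arr (A ∷ As))} {N N' : Tm Γ A} →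
          M ≈ M' → N ≈ N' → app M N ≈ app M' N'
  lamc  : ∀ {A As} {M M' : Tm (A ∷ Γ) (arr As)} →
          M ≈ M' → lam M ≈ lam M'
  ≈refl  : ∀ {A} {M : Tm Γ A} → M ≈ M
  ≈sym   : ∀ {A} {M N : Tm Γ A} → M ≈ N → N ≈ M
  ≈trans : ∀ {A} {M N P : Tm Γ A} → M ≈ N → N ≈ P → M ≈ P

data Args (Γ : Ctx) : List Ty → Set where
  []  : Args Γ []
  _∷_ : ∀ {A As} → Tm Γ A → Args Γ As → Args Γ (A ∷ As)

apps : ∀ {Γ As} → Tm Γ (arr As) → Args Γ As → Tm Γ o
apps M []       = M
apps M (N ∷ Ns) = apps (app M N) Ns

data ArgsEq {Γ : Ctx} : ∀ {As} → Args Γ As → Args Γ As → Set where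
  []  : ArgsEq [] []
  _∷_ : ∀ {A As} {M N : Tm Γ A} {Ms Ns : Args Γ As} →
        M ≈ N → ArgsEq Ms Ns → ArgsEq (M ∷ Ms) (N ∷ Ns)

data SameHeadArgs {Γ Δ : Ctx} : ∀ {As Bs} → Γ ∋ arr As → Args Δ As →
                                Γ ∋ arr Bs → Args Δ Bs → Set where
  same : ∀ {As} {a : Γ ∋ arr As} {Ms Ns : Args Δ As} →
         ArgsEq Ms Ns → SameHeadArgs a Ms a Ns

-- context concatenation Ξ,Γ is Ξ ++ Γ; inclusions and splitting of variables
inl : ∀ Ξ {Γ A} → Ξ ∋ A → (Ξ ++ Γ) ∋ A
inl (_ ∷ Ξ) here      = here
inl (_ ∷ Ξ) (there x) = there (inl Ξ x)

inr : ∀ Ξ {Γ A} → Γ ∋ A → (Ξ ++ Γ) ∋ A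
inr []      x = x
inr (_ ∷ Ξ) x = there (inr Ξ x)

split : ∀ Ξ {Γ A} → (Ξ ++ Γ) ∋ A → (Ξ ∋ A) ⊎ (Γ ∋ A)
split []      x         = inj₂ x
split (_ ∷ Ξ) here      = inj₁ here
split (_ ∷ Ξ) (there x) with split Ξ x
... | inj₁ y = inj₁ (there y)
... | inj₂ y = inj₂ y

extSub : ∀ Ξ {Γ Δ} → Sub Γ Δ → Sub (Ξ ++ Γ) (Ξ ++ Δ)
extSub Ξ ρ x with split Ξ x
... | inj₁ d = var (inl Ξ d)
... | inj₂ c = ren (inr Ξ) (ρ c)

hatSub : ∀ Ξ {Γ Δ} → Sub Γ Δ → Tm (Ξ ++ Γ) o → Tm (Ξ ++ Δ) o
hatSub Ξ ρ M = sub (extSub Ξ ρ) M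

StrongReduction : ∀ {Γ Δ} → Sub Γ Δ → Set
StrongReduction {Γ} {Δ} ρ =
  ∀ (Ξ : Ctx) (M N : Tm (Ξ ++ Γ) o) → hatSub Ξ ρ M ≈ hatSub Ξ ρ N → M ≈ N

-- Every term is βη-equal to a β-normal η-long form (only existence of normal forms is needed, not their
-- uniqueness), obtained here from a Kripke reducibility predicate. Injectivity of ϱ̂^Ξ is then proved by
-- induction on a normal form m of M, for all Ξ at once. If m = λx.m', η-expand N, strip the λ on both
-- sides after substitution (λ is injective up to βη via β), and conclude with Ξ extended by x. If
-- m = a M₁⋯Mₙ, normalise N to b N₁⋯Nₘ; the hypothesis applied to ϱ^Ξ_a (ϱ̂M₁)⋯ =βη ϱ^Ξ_b (ϱ̂N₁)⋯ gives
-- a = b and ϱ̂Mᵢ =βη ϱ̂Nᵢ, so Mᵢ =βη Nᵢ by induction.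
module Submission where

open import Defs
open import Data.List using (List; []; _∷_; _++_)
open import Data.Sum using (inj₁; inj₂)
open import Data.Product using (Σ; _,_; proj₁; proj₂)
open import Relation.Binary.PropositionalEquality
  using (_≡_; refl; sym; trans; cong; cong₂; subst; module ≡-Reasoning)

≡⇒≈ : ∀ {Γ A} {M N : Tm Γ A} → M ≡ N → M ≈ N
≡⇒≈ refl = ≈refl

liftR-ext : ∀ {Γ Δ B} {r r′ : Ren Γ Δ} → (∀ {A} (x : Γ ∋ A) → r x ≡ r′ x) →
            ∀ {A} (x : (B ∷ Γ) ∋ A) → liftR r x ≡ liftR r′ x
liftR-ext e here      = refl
liftR-ext e (there x) = cong there (e x)

ren-ext : ∀ {Γ Δ A} {r r′ : Ren Γ Δ} → (∀ {B} (x : Γ ∋ B) → r x ≡ r′ x) →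
          (t : Tm Γ A) → ren r t ≡ ren r′ t
ren-ext e (var x)   = cong var (e x)
ren-ext e (app M N) = cong₂ app (ren-ext e M) (ren-ext e N)
ren-ext e (lam M)   = cong lam (ren-ext (liftR-ext e) M)

liftS-ext : ∀ {Γ Δ B} {σ τ : Sub Γ Δ} → (∀ {A} (x : Γ ∋ A) → σ x ≡ τ x) →
            ∀ {A} (x : (B ∷ Γ) ∋ A) → liftS σ x ≡ liftS τ x
liftS-ext e here      = refl
liftS-ext e (there x) = cong wk (e x)

sub-ext : ∀ {Γ Δ A} {σ τ : Sub Γ Δ} → (∀ {B} (x : Γ ∋ B) → σ x ≡ τ x) →
          (t : Tm Γ A) → sub σ t ≡ sub τ t
sub-ext e (var x)   = e x
sub-ext e (app M N) = cong₂ app (sub-ext e M) (sub-ext e N)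
sub-ext e (lam M)   = cong lam (sub-ext (liftS-ext e) M)

ren-id : ∀ {Γ A} (t : Tm Γ A) → ren (λ x → x) t ≡ t
ren-id (var x)   = refl
ren-id (app M N) = cong₂ app (ren-id M) (ren-id N)
ren-id (lam M)   = cong lam (trans (ren-ext liftR-id M) (ren-id M))
  where
  liftR-id : ∀ {B} (x : _ ∋ B) → liftR (λ y → y) x ≡ x
  liftR-id here      = refl
  liftR-id (there x) = refl

ren-ren : ∀ {Γ Δ Θ A} (r : Ren Δ Θ) (r′ : Ren Γ Δ) (t : Tm Γ A) →
          ren r (ren r′ t) ≡ ren (λ x → r (r′ x)) t
ren-ren r r′ (var x)   = refl
ren-ren r r′ (app M N) = cong₂ app (ren-ren r r′ M) (ren-ren r r′ N)
ren-ren r r′ (lam M)   = cong lam (trans (ren-ren (liftR r) (liftR r′) M) (ren-ext liftR-∘ M))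
  where
  liftR-∘ : ∀ {B} (x : _ ∋ B) → liftR r (liftR r′ x) ≡ liftR (λ y → r (r′ y)) x
  liftR-∘ here      = refl
  liftR-∘ (there x) = refl

ren-sub : ∀ {Γ Δ Θ A} (r : Ren Δ Θ) (σ : Sub Γ Δ) (t : Tm Γ A) →
          ren r (sub σ t) ≡ sub (λ x → ren r (σ x)) t
ren-sub r σ (var x)   = refl
ren-sub r σ (app M N) = cong₂ app (ren-sub r σ M) (ren-sub r σ N)
ren-sub r σ (lam M)   = cong lam (trans (ren-sub (liftR r) (liftS σ) M) (sub-ext lift-∘ M))
  where
  lift-∘ : ∀ {B} (x : _ ∋ B) → ren (liftR r) (liftS σ x) ≡ liftS (λ y → ren r (σ y)) x
  lift-∘ here      = refl
  lift-∘ (there x) = trans (ren-ren (liftR r) there (σ x)) (sym (ren-ren there r (σ x)))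

sub-ren : ∀ {Γ Δ Θ A} (σ : Sub Δ Θ) (r : Ren Γ Δ) (t : Tm Γ A) →
          sub σ (ren r t) ≡ sub (λ x → σ (r x)) t
sub-ren σ r (var x)   = refl
sub-ren σ r (app M N) = cong₂ app (sub-ren σ r M) (sub-ren σ r N)
sub-ren σ r (lam M)   = cong lam (trans (sub-ren (liftS σ) (liftR r) M) (sub-ext lift-∘ M))
  where
  lift-∘ : ∀ {B} (x : _ ∋ B) → liftS σ (liftR r x) ≡ liftS (λ y → σ (r y)) x
  lift-∘ here      = refl
  lift-∘ (there x) = refl

sub-sub : ∀ {Γ Δ Θ A} (τ : Sub Δ Θ) (σ : Sub Γ Δ) (t : Tm Γ A) →
          sub τ (sub σ t) ≡ sub (λ x → sub τ (σ x)) t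
sub-sub τ σ (var x)   = refl
sub-sub τ σ (app M N) = cong₂ app (sub-sub τ σ M) (sub-sub τ σ N)
sub-sub τ σ (lam M)   = cong lam (trans (sub-sub (liftS τ) (liftS σ) M) (sub-ext liftS-∘ M))
  where
  liftS-∘ : ∀ {B} (x : _ ∋ B) → sub (liftS τ) (liftS σ x) ≡ liftS (λ y → sub τ (σ y)) x
  liftS-∘ here      = refl
  liftS-∘ (there x) = trans (sub-ren (liftS τ) there (σ x)) (sym (ren-sub there τ (σ x)))

sub-id : ∀ {Γ A} (t : Tm Γ A) → sub var t ≡ t
sub-id (var x)   = refl
sub-id (app M N) = cong₂ app (sub-id M) (sub-id N)
sub-id (lam M)   = cong lam (trans (sub-ext liftS-var M) (sub-id M))
  where
  liftS-var : ∀ {B} (x : _ ∋ B) → liftS var x ≡ var x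
  liftS-var here      = refl
  liftS-var (there x) = refl

sub-var∘ : ∀ {Γ Δ A} (r : Ren Γ Δ) (t : Tm Γ A) → sub (λ y → var (r y)) t ≡ ren r t
sub-var∘ r t = trans (sym (sub-ren var r t)) (sub-id (ren r t))

ren-≈ : ∀ {Γ Δ A} (r : Ren Γ Δ) {M N : Tm Γ A} → M ≈ N → ren r M ≈ ren r N
ren-≈ r (β M N) = ≈trans (β _ _) (≡⇒≈ (begin
    sub (single (ren r N)) (ren (liftR r) M)  ≡⟨ sub-ren _ (liftR r) M ⟩
    sub (λ x → single (ren r N) (liftR r x)) M ≡⟨ sub-ext single-ren M ⟩
    sub (λ x → ren r (single N x)) M           ≡⟨ sym (ren-sub r (single N) M) ⟩
    ren r (sub (single N) M)                   ∎))
  where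
  open ≡-Reasoning
  single-ren : ∀ {B} (x : _ ∋ B) → single (ren r N) (liftR r x) ≡ ren r (single N x)
  single-ren here      = refl
  single-ren (there x) = refl
ren-≈ r (η M) = ≈trans (η (ren r M)) (≡⇒≈ (cong (λ u → lam (app u (var here)))
                  (trans (ren-ren there r M) (sym (ren-ren (liftR r) there M)))))
ren-≈ r (appc e f)   = appc (ren-≈ r e) (ren-≈ r f)
ren-≈ r (lamc e)     = lamc (ren-≈ (liftR r) e)
ren-≈ r ≈refl        = ≈refl
ren-≈ r (≈sym e)     = ≈sym (ren-≈ r e)
ren-≈ r (≈trans e f) = ≈trans (ren-≈ r e) (ren-≈ r f)

sub-≈ : ∀ {Γ Δ A} (σ : Sub Γ Δ) {M N : Tm Γ A} → M ≈ N → sub σ M ≈ sub σ N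
sub-≈ σ (β M N) = ≈trans (β _ _) (≡⇒≈ (begin
    sub (single (sub σ N)) (sub (liftS σ) M)          ≡⟨ sub-sub _ (liftS σ) M ⟩
    sub (λ x → sub (single (sub σ N)) (liftS σ x)) M ≡⟨ sub-ext single-sub M ⟩
    sub (λ x → sub σ (single N x)) M                  ≡⟨ sym (sub-sub σ (single N) M) ⟩
    sub σ (sub (single N) M)                          ∎))
  where
  open ≡-Reasoning
  single-sub : ∀ {B} (x : _ ∋ B) → sub (single (sub σ N)) (liftS σ x) ≡ sub σ (single N x)
  single-sub here      = refl
  single-sub (there x) = trans (sub-ren (single (sub σ N)) there (σ x)) (sub-id (σ x))
sub-≈ σ (η M) = ≈trans (η (sub σ M)) (≡⇒≈ (cong (λ u → lam (app u (var here)))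
                  (trans (ren-sub there σ M) (sym (sub-ren (liftS σ) there M)))))
sub-≈ σ (appc e f)   = appc (sub-≈ σ e) (sub-≈ σ f)
sub-≈ σ (lamc e)     = lamc (sub-≈ (liftS σ) e)
sub-≈ σ ≈refl        = ≈refl
sub-≈ σ (≈sym e)     = ≈sym (sub-≈ σ e)
sub-≈ σ (≈trans e f) = ≈trans (sub-≈ σ e) (sub-≈ σ f)

app-wk-lam-here : ∀ {Γ A As} (P : Tm (A ∷ Γ) (arr As)) → app (wk (lam P)) (var here) ≈ P
app-wk-lam-here P = ≈trans (β _ _) (≡⇒≈ (begin
    sub (single (var here)) (ren (liftR there) P)   ≡⟨ sub-ren _ (liftR there) P ⟩
    sub (λ x → single (var here) (liftR there x)) P ≡⟨ sub-ext single-here P ⟩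
    sub var P                                       ≡⟨ sub-id P ⟩
    P                                               ∎))
  where
  open ≡-Reasoning
  single-here : ∀ {B} (x : _ ∋ B) → single (var here) (liftR there x) ≡ var x
  single-here here      = refl
  single-here (there x) = refl

lam-injective : ∀ {Γ A As} {P Q : Tm (A ∷ Γ) (arr As)} → lam P ≈ lam Q → P ≈ Q
lam-injective {P = P} {Q} e =
  ≈trans (≈sym (app-wk-lam-here P)) (≈trans (appc (ren-≈ there e) ≈refl) (app-wk-lam-here Q))

apps-congˡ : ∀ {Γ As} {M M′ : Tm Γ (arr As)} (Ms : Args Γ As) → M ≈ M′ → apps M Ms ≈ apps M′ Ms
apps-congˡ []       e = e
apps-congˡ (_ ∷ Ms) e = apps-congˡ Ms (appc e ≈refl)

apps-congʳ : ∀ {Γ As} (M : Tm Γ (arr As)) {Ms Ns : Args Γ As} → ArgsEq Ms Ns → apps M Ms ≈ apps M Ns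
apps-congʳ M [] = ≈refl
apps-congʳ M {_ ∷ Ms} {N ∷ _} (e ∷ es) =
  ≈trans (apps-congˡ Ms (appc ≈refl e)) (apps-congʳ (app M N) es)

subArgs : ∀ {Γ Δ As} → Sub Γ Δ → Args Γ As → Args Δ As
subArgs σ []       = []
subArgs σ (M ∷ Ms) = sub σ M ∷ subArgs σ Ms

sub-apps : ∀ {Γ Δ As} (σ : Sub Γ Δ) (M : Tm Γ (arr As)) (Ms : Args Γ As) →
           sub σ (apps M Ms) ≡ apps (sub σ M) (subArgs σ Ms)
sub-apps σ M []       = refl
sub-apps σ M (N ∷ Ms) = sub-apps σ (app M N) Ms

-- β-normal η-long forms: λ-abstractions over a fully applied variable
mutual
  data Nf (Γ : Ctx) : Ty → Set where
    lamN : ∀ {A As} → Nf (A ∷ Γ) (arr As) → Nf Γ (arr (A ∷ As))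
    neN  : ∀ {As} → Γ ∋ arr As → NfArgs Γ As → Nf Γ o

  data NfArgs (Γ : Ctx) : List Ty → Set where
    []  : NfArgs Γ []
    _∷_ : ∀ {A As} → Nf Γ A → NfArgs Γ As → NfArgs Γ (A ∷ As)

mutual
  ⌜_⌝ : ∀ {Γ A} → Nf Γ A → Tm Γ A
  ⌜ lamN m ⌝   = lam ⌜ m ⌝
  ⌜ neN x ms ⌝ = apps (var x) ⌜ ms ⌝s

  ⌜_⌝s : ∀ {Γ As} → NfArgs Γ As → Args Γ As
  ⌜ [] ⌝s     = []
  ⌜ m ∷ ms ⌝s = ⌜ m ⌝ ∷ ⌜ ms ⌝s

HasNf : ∀ {Γ A} → Tm Γ A → Set
HasNf {Γ} {A} t = Σ (Nf Γ A) λ n → t ≈ ⌜ n ⌝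

mutual
  Red : ∀ {Γ} A → Tm Γ A → Set
  Red (arr As) t = RedL As t

  RedL : ∀ {Γ} As → Tm Γ (arr As) → Set
  RedL {Γ} []       t = ∀ {Δ} (r : Ren Γ Δ) → HasNf (ren r t)
  RedL {Γ} (A ∷ As) t = ∀ {Δ} (r : Ren Γ Δ) (s : Tm Δ A) → Red A s → RedL As (app (ren r t) s)

ren-RedL : ∀ {Γ Δ} As (r : Ren Γ Δ) {t : Tm Γ (arr As)} → RedL As t → RedL As (ren r t)
ren-RedL []       r {t} h r′      = subst HasNf (sym (ren-ren r′ r t)) (h (λ x → r′ (r x)))
ren-RedL (A ∷ As) r {t} h r′ s hs =
  subst (RedL As) (cong (λ u → app u s) (sym (ren-ren r′ r t))) (h (λ x → r′ (r x)) s hs)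

ren-Red : ∀ {Γ Δ} A (r : Ren Γ Δ) {t : Tm Γ A} → Red A t → Red A (ren r t)
ren-Red (arr As) = ren-RedL As

RedL-≈ : ∀ {Γ} As {t t′ : Tm Γ (arr As)} → t ≈ t′ → RedL As t → RedL As t′
RedL-≈ []       e h r      = let (n , e′) = h r in n , ≈trans (≈sym (ren-≈ r e)) e′
RedL-≈ (A ∷ As) e h r s hs = RedL-≈ As (appc (ren-≈ r e) ≈refl) (h r s hs)

mutual
  -- k r ns is the normal form of (ren r t) applied to ⌜ ns ⌝s: t behaves like a neutral term
  reflectL : ∀ {Γ} As (t : Tm Γ (arr As)) (k : ∀ {Δ} → Ren Γ Δ → NfArgs Δ As → Nf Δ o) →
             (∀ {Δ} (r : Ren Γ Δ) (ns : NfArgs Δ As) → apps (ren r t) ⌜ ns ⌝s ≈ ⌜ k r ns ⌝) →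
             RedL As t
  reflectL []       t k p r      = k r [] , p r []
  reflectL (A ∷ As) t k p r s hs = reflectL As (app (ren r t) s) k′ p′
    where
    nf-s : ∀ {Δ′} (r′ : Ren _ Δ′) → HasNf (ren r′ s)
    nf-s r′ = reify A (ren-Red A r′ hs)
    k′ : ∀ {Δ′} → Ren _ Δ′ → NfArgs Δ′ As → Nf Δ′ o
    k′ r′ ns = k (λ x → r′ (r x)) (proj₁ (nf-s r′) ∷ ns)
    p′ : ∀ {Δ′} (r′ : Ren _ Δ′) (ns : NfArgs Δ′ As) →
         apps (ren r′ (app (ren r t) s)) ⌜ ns ⌝s ≈ ⌜ k′ r′ ns ⌝
    p′ r′ ns = ≈trans (apps-congˡ ⌜ ns ⌝s (appc (≡⇒≈ (ren-ren r′ r t)) (proj₂ (nf-s r′))))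
                      (p (λ x → r′ (r x)) (proj₁ (nf-s r′) ∷ ns))

  var-Red : ∀ {Γ A} (x : Γ ∋ A) → Red A (var x)
  var-Red {A = arr As} x = reflectL As (var x) (λ r ns → neN (r x) ns) (λ r ns → ≈refl)

  reify : ∀ {Γ} A {t : Tm Γ A} → Red A t → HasNf t
  reify (arr As) = reifyL As

  reifyL : ∀ {Γ} As {t : Tm Γ (arr As)} → RedL As t → HasNf t
  reifyL [] {t} h = let (n , e) = h (λ x → x) in n , ≈trans (≡⇒≈ (sym (ren-id t))) e
  reifyL (A ∷ As) {t} h =
    let (n , e) = reifyL As (h there (var here) (var-Red {A = A} here)) in lamN n , ≈trans (η t) (lamc e)

_∷ˢ_ : ∀ {Γ Δ A} → Tm Δ A → Sub Γ Δ → Sub (A ∷ Γ) Δ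
(s ∷ˢ σ) here      = s
(s ∷ˢ σ) (there x) = σ x

sub-Red : ∀ {Γ Δ A} (t : Tm Γ A) (σ : Sub Γ Δ) → (∀ {B} (x : Γ ∋ B) → Red B (σ x)) → Red A (sub σ t)
sub-Red (var x) σ hσ = hσ x
sub-Red (app {A} {As} M N) σ hσ =
  subst (RedL As) (cong (λ u → app u (sub σ N)) (ren-id (sub σ M)))
        (sub-Red M σ hσ (λ x → x) (sub σ N) (sub-Red N σ hσ))
sub-Red {Γ} (lam {A} {As} M) σ hσ {Δ′} r s hs =
  RedL-≈ As (≈sym (≈trans (β _ s) (≡⇒≈ β-result))) (sub-Red M env env-Red)
  where
  open ≡-Reasoning
  env : Sub (A ∷ Γ) Δ′
  env = s ∷ˢ (λ x → ren r (σ x))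
  env-Red : ∀ {B} (x : (A ∷ Γ) ∋ B) → Red B (env x)
  env-Red here          = hs
  env-Red {B} (there x) = ren-Red B r (hσ x)
  lift-env : ∀ {B} (x : (A ∷ Γ) ∋ B) → sub (λ y → single s (liftR r y)) (liftS σ x) ≡ env x
  lift-env here      = refl
  lift-env (there x) = trans (sub-ren (λ y → single s (liftR r y)) there (σ x)) (sub-var∘ r (σ x))
  β-result : sub (single s) (ren (liftR r) (sub (liftS σ) M)) ≡ sub env M
  β-result = begin
    sub (single s) (ren (liftR r) (sub (liftS σ) M))     ≡⟨ sub-ren (single s) (liftR r) (sub (liftS σ) M) ⟩
    sub (λ y → single s (liftR r y)) (sub (liftS σ) M)   ≡⟨ sub-sub (λ y → single s (liftR r y)) (liftS σ) M ⟩
    sub (λ x → sub (λ y → single s (liftR r y)) (liftS σ x)) M ≡⟨ sub-ext lift-env M ⟩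
    sub env M                                            ∎

normalise : ∀ {Γ A} (t : Tm Γ A) → HasNf t
normalise {A = A} t = reify A (subst (Red A) (sub-id t) (sub-Red t var var-Red))

liftS-extSub : ∀ Ξ {Γ Δ} (ρ : Sub Γ Δ) C {A} (x : (C ∷ (Ξ ++ Γ)) ∋ A) →
               liftS (extSub Ξ ρ) x ≡ extSub (C ∷ Ξ) ρ x
liftS-extSub Ξ ρ C here = refl
liftS-extSub Ξ ρ C (there x) with split Ξ x
... | inj₁ d = refl
... | inj₂ c = ren-ren there (inr Ξ) (ρ c)

ReflectsHeadsAndArgs : ∀ {Γ Δ} → Sub Γ Δ → Set
ReflectsHeadsAndArgs {Γ} {Δ} ρ =
  ∀ (Ξ : Ctx) {As Bs : List Ty} (a : (Ξ ++ Γ) ∋ arr As) (b : (Ξ ++ Γ) ∋ arr Bs)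
    (Ms : Args (Ξ ++ Δ) As) (Ns : Args (Ξ ++ Δ) Bs) →
    apps (extSub Ξ ρ a) Ms ≈ apps (extSub Ξ ρ b) Ns → SameHeadArgs a Ms b Ns

module _ {Γ Δ : Ctx} {ρ : Sub Γ Δ} (reflects : ReflectsHeadsAndArgs ρ) where

  mutual
    nf-reflect : ∀ Ξ {A} (m : Nf (Ξ ++ Γ) A) (N : Tm (Ξ ++ Γ) A) →
                 sub (extSub Ξ ρ) ⌜ m ⌝ ≈ sub (extSub Ξ ρ) N → ⌜ m ⌝ ≈ N
    nf-reflect Ξ (lamN {C} m) N e = ≈trans (lamc (nf-reflect (C ∷ Ξ) m N′ e′)) (≈sym (η N))
      where
      N′ = app (wk N) (var here)
      lift-≈ : sub (liftS (extSub Ξ ρ)) ⌜ m ⌝ ≈ sub (liftS (extSub Ξ ρ)) N′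
      lift-≈ = lam-injective (≈trans e (sub-≈ (extSub Ξ ρ) (η N)))
      e′ : sub (extSub (C ∷ Ξ) ρ) ⌜ m ⌝ ≈ sub (extSub (C ∷ Ξ) ρ) N′
      e′ = ≈trans (≡⇒≈ (sym (sub-ext (liftS-extSub Ξ ρ C) ⌜ m ⌝)))
                  (≈trans lift-≈ (≡⇒≈ (sub-ext (liftS-extSub Ξ ρ C) N′)))
    nf-reflect Ξ (neN a ms) N e with normalise N
    ... | neN b ns , N≈ = ≈trans (ne-reflect Ξ a b ms ns spine-≈) (≈sym N≈)
      where
      σ = extSub Ξ ρ
      spine-≈ = ≈trans (≡⇒≈ (sym (sub-apps σ (var a) ⌜ ms ⌝s)))
                  (≈trans e (≈trans (sub-≈ σ N≈) (≡⇒≈ (sub-apps σ (var b) ⌜ ns ⌝s))))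

    ne-reflect : ∀ Ξ {As Bs} (a : (Ξ ++ Γ) ∋ arr As) (b : (Ξ ++ Γ) ∋ arr Bs)
                 (ms : NfArgs (Ξ ++ Γ) As) (ns : NfArgs (Ξ ++ Γ) Bs) →
                 apps (extSub Ξ ρ a) (subArgs (extSub Ξ ρ) ⌜ ms ⌝s) ≈
                   apps (extSub Ξ ρ b) (subArgs (extSub Ξ ρ) ⌜ ns ⌝s) →
                 apps (var a) ⌜ ms ⌝s ≈ apps (var b) ⌜ ns ⌝s
    ne-reflect Ξ a b ms ns e
      with reflects Ξ a b (subArgs (extSub Ξ ρ) ⌜ ms ⌝s) (subArgs (extSub Ξ ρ) ⌜ ns ⌝s) e
    ... | same args-≈ = apps-congʳ (var a) (nfArgs-reflect Ξ ms ns args-≈)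

    nfArgs-reflect : ∀ Ξ {As} (ms ns : NfArgs (Ξ ++ Γ) As) →
                     ArgsEq (subArgs (extSub Ξ ρ) ⌜ ms ⌝s) (subArgs (extSub Ξ ρ) ⌜ ns ⌝s) →
                     ArgsEq ⌜ ms ⌝s ⌜ ns ⌝s
    nfArgs-reflect Ξ []       []       []       = []
    nfArgs-reflect Ξ (m ∷ ms) (n ∷ ns) (e ∷ es) = nf-reflect Ξ m ⌜ n ⌝ e ∷ nfArgs-reflect Ξ ms ns es

theoremT : ∀ (Γ Δ : Ctx) (ρ : Sub Γ Δ) →
    (∀ (Ξ : Ctx) {As Bs : List Ty}
       (a : (Ξ ++ Γ) ∋ arr As) (b : (Ξ ++ Γ) ∋ arr Bs)
       (Ms : Args (Ξ ++ Δ) As) (Ns : Args (Ξ ++ Δ) Bs) →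
       apps (extSub Ξ ρ a) Ms ≈ apps (extSub Ξ ρ b) Ns →
       SameHeadArgs a Ms b Ns) →
    StrongReduction ρ
theoremT Γ Δ ρ reflects Ξ M N e =
  let (m , M≈) = normalise M
  in ≈trans M≈ (nf-reflect {ρ = ρ} reflects Ξ m N (≈trans (≈sym (sub-≈ (extSub Ξ ρ) M≈)) e))
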